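{- Let $V$ be a finite set with $|V|\ge 5$ and let $\mathcal{B}$ be a pseudometric betweenness on $V$ such that $\{\{u,v,w\}:(u,v,w)\in\mathcal{B}\}=\binom{V}{3}$. Then there is an injection $f:V\to\mathbb{R}$ such that for all $x,y,z\in V$, $(x,y,z)\in\mathcal{B}$ if and only if $f(y)$ is strictly between $f(x)$ and $f(z)$.
   Context: $\binom{V}{3}$ denotes the set of three-element subsets of $V$. A pseudometric betweenness on $V$ is a ternary relation $\mathcal{B}\subseteq V^3$ such that: (M0) if $(u,v,w)\in\mathcal{B}$ then $u,v,w$ are pairwise distinct; (M1) if $(u,v,w)\in\mathcal{B}$ then $(w,v,u)\in\mathcal{B}$; (M2) if $(u,v,w)\in\mathcal{B}$ then $(u,w,v)\notin\mathcal{B}$; (M3) if $(u,v,w)\in\mathcal{B}$ and $(u,w,x)\in\mathcal{B}$ then $(u,v,x)\in\mathcal{B}$ and $(v,w,x)\in\mathcal{B}$. -}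

module Defs where

open import Data.Product using (_×_; ∃-syntax)
open import Data.Sum using (_⊎_)
open import Relation.Nullary using (¬_)
open import Relation.Binary.PropositionalEquality using (_≡_; _≢_)
open import Function.Bundles using (_⇔_)
open import Data.Rational using (ℚ; _<_)

Ternary : Set → Set₁
Ternary V = V → V → V → Set

record PseudometricBetweenness {V : Set} (B : Ternary V) : Set where
  field
    M0 : ∀ {u v w} → B u v w → (u ≢ v) × (v ≢ w) × (u ≢ w)
    M1 : ∀ {u v w} → B u v w → B w v u
    M2 : ∀ {u v w} → B u v w → ¬ B u w v
    M3 : ∀ {u v w x} → B u v w → B u w x → B u v x × B v w x

_∈₃_ : {V : Set} → V → V × V × V → Set
_∈₃_ x (a Data.Product., b Data.Product., c) = x ≡ a ⊎ x ≡ b ⊎ x ≡ c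

Distinct₃ : {V : Set} → V → V → V → Set
Distinct₃ u v w = (u ≢ v) × (v ≢ w) × (u ≢ w)

-- {{u,v,w} : (u,v,w) ∈ B} = binom(V,3):
--   (⊆) every triple of B spans a 3-element subset, and
--   (⊇) every 3-element subset {u,v,w} equals {a,b,c} for some (a,b,c) ∈ B.
CoversAllTriples : {V : Set} → Ternary V → Set
CoversAllTriples {V} B =
  (∀ a b c → B a b c → Distinct₃ a b c)
  × (∀ u v w → Distinct₃ u v w →
       ∃[ a ] ∃[ b ] ∃[ c ] (B a b c ×
         (∀ x → (x ∈₃ (a Data.Product., b Data.Product., c)) ⇔ (x ∈₃ (u Data.Product., v Data.Product., w)))))

StrictlyBetween : ℚ → ℚ → ℚ → Set
StrictlyBetween p q r = (p < q × q < r) ⊎ (r < q × q < p)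

-- Totality (every three distinct points have a middle one) makes "v lies between a and w"
-- a strict order in v, w for fixed a, so there is a point m farthest from a.  Such an m is
-- never a middle point: otherwise there are x, y with B x m y, both between a and m, and
-- then x, a, y, m form a 4-cycle.  A 4-cycle realises every triple of its own points, but
-- no fifth point can be placed relative to it, which is where |V| ≥ 5 is needed.  Hence
-- x ≺ y ⇔ (x = m ≠ y or B m x y) is a strict total order whose betweenness is B, and
-- counting ≺-predecessors embeds it into ℚ.
module Submission where

open import Defs
open import Data.Empty using (⊥)
open import Data.Fin using (Fin; zero; suc; _≟_)
open import Data.Fin.Properties using (any?; all?; injective⇒≤)
open import Data.Integer as ℤ using (+_; +<+)
open import Data.Integer.Properties using (*-identityʳ)
open import Data.Nat using (ℕ; zero; suc; _≥_; _≤_; _<_; z≤n; s≤s)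
open import Data.Nat.Properties using (m≤n⇒m≤1+n; <⇒≱)
open import Data.Product using (_×_; Σ; ∃; _,_; proj₁; proj₂)
open import Data.Rational as ℚ using (ℚ; *<*)
open import Data.Rational.Literals using (fromℤ)
import Data.Rational.Properties as ℚ
open import Data.Sum using (_⊎_; inj₁; inj₂)
open import Data.Vec using (_∷_; []; lookup)
open import Function using (_∘_)
open import Function.Bundles using (_⇔_; mk⇔; Equivalence)
open import Function.Definitions using (Injective)
open import Function.Properties.Equivalence using () renaming (trans to ⇔-trans)
open import Level using (0ℓ)
open import Relation.Binary.Core using (Rel)
open import Relation.Binary.Definitions
  using (Transitive; Irreflexive; DecidableEquality) renaming (Decidable to Decidable₂)
open import Relation.Binary.PropositionalEquality
  using (_≡_; _≢_; refl; sym; trans; cong; subst₂; ≢-sym)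
open import Relation.Nullary using (¬_; Dec; yes; no; ¬?; contradiction)
open import Relation.Unary using (Pred; Decidable; _⊆_)

count : ∀ {k} {P : Pred (Fin k) 0ℓ} → Decidable P → ℕ
count {zero}  P? = 0
count {suc k} P? with P? zero
... | yes _ = suc (count (P? ∘ suc))
... | no  _ = count (P? ∘ suc)

count-mono : ∀ {k} {P Q : Pred (Fin k) 0ℓ} (P? : Decidable P) (Q? : Decidable Q) →
             P ⊆ Q → count P? ≤ count Q?
count-mono {zero}  P? Q? P⊆Q = z≤n
count-mono {suc k} P? Q? P⊆Q with P? zero | Q? zero
... | yes _ | yes _  = s≤s (count-mono (P? ∘ suc) (Q? ∘ suc) P⊆Q)
... | yes p | no ¬q  = contradiction (P⊆Q p) ¬q
... | no  _ | yes _  = m≤n⇒m≤1+n (count-mono (P? ∘ suc) (Q? ∘ suc) P⊆Q)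
... | no  _ | no  _  = count-mono (P? ∘ suc) (Q? ∘ suc) P⊆Q

count-strict-mono : ∀ {k} {P Q : Pred (Fin k) 0ℓ} (P? : Decidable P) (Q? : Decidable Q) →
                    P ⊆ Q → ∀ {j} → Q j → ¬ P j → count P? < count Q?
count-strict-mono {suc k} P? Q? P⊆Q {zero} Qj ¬Pj with P? zero | Q? zero
... | yes Pj | _     = contradiction Pj ¬Pj
... | no  _  | yes _ = s≤s (count-mono (P? ∘ suc) (Q? ∘ suc) P⊆Q)
... | no  _  | no ¬Qj = contradiction Qj ¬Qj
count-strict-mono {suc k} P? Q? P⊆Q {suc j} Qj ¬Pj with P? zero | Q? zero
... | yes _ | yes _ = s≤s (count-strict-mono (P? ∘ suc) (Q? ∘ suc) P⊆Q Qj ¬Pj)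
... | yes p | no ¬q = contradiction (P⊆Q p) ¬q
... | no  _ | yes _ = m≤n⇒m≤1+n (count-strict-mono (P? ∘ suc) (Q? ∘ suc) P⊆Q Qj ¬Pj)
... | no  _ | no  _ = count-strict-mono (P? ∘ suc) (Q? ∘ suc) P⊆Q Qj ¬Pj

∃-∉-image : ∀ {m n} → m < n → (p : Fin m → Fin n) → ∃ λ z → ∀ i → p i ≢ z
∃-∉-image {m} {n} m<n p with any? (λ z → all? (λ i → ¬? (p i ≟ z)))
... | yes fresh = fresh
... | no  none  = contradiction (injective⇒≤ preimage-injective) (<⇒≱ m<n)
  where
  preimage : ∀ z → ∃ λ i → p i ≡ z
  preimage z with any? (λ i → p i ≟ z)
  ... | yes hit  = hit
  ... | no  miss = contradiction (z , λ i e → miss (i , e)) none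

  preimage-injective : Injective _≡_ _≡_ (proj₁ ∘ preimage)
  preimage-injective {z} {w} e =
    trans (sym (proj₂ (preimage z))) (trans (cong p e) (proj₂ (preimage w)))

module _ {A : Set} {R : Rel A 0ℓ}
         (R-trans : Transitive R) (R-irrefl : Irreflexive _≡_ R) (R? : Decidable₂ R) where

  ∃-maximal : ∀ {k} (g : Fin (suc k) → A) → ∃ λ j → ∀ i → ¬ R (g j) (g i)
  ∃-maximal {zero}  g = zero , λ { zero → R-irrefl refl }
  ∃-maximal {suc k} g with ∃-maximal (g ∘ suc)
  ... | j , max with R? (g (suc j)) (g zero)
  ... | yes gj<g0 = zero , λ { zero → R-irrefl refl ; (suc i) g0<gi → max i (R-trans gj<g0 g0<gi) }
  ... | no  gj≮g0 = suc j , λ { zero → gj≮g0 ; (suc i) → max i }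

Between : {A : Set} → Rel A 0ℓ → A → A → A → Set
Between _<_ x y z = (x < y × y < z) ⊎ (z < y × y < x)

ℕ→ℚ : ℕ → ℚ
ℕ→ℚ k = fromℤ (+ k)

ℕ→ℚ-mono-< : ∀ {m n} → m < n → ℕ→ℚ m ℚ.< ℕ→ℚ n
ℕ→ℚ-mono-< {m} {n} m<n =
  *<* (subst₂ ℤ._<_ (sym (*-identityʳ (+ m))) (sym (*-identityʳ (+ n))) (+<+ m<n))

module RankEmbedding {n} {_≺_ : Rel (Fin n) 0ℓ} (≺-trans : Transitive _≺_)
         (≺-irrefl : Irreflexive _≡_ _≺_) (≺-connex : ∀ {x y} → x ≢ y → x ≺ y ⊎ y ≺ x) where

  _≺?_ : Decidable₂ _≺_
  x ≺? y with x ≟ y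
  ... | yes x≡y = no (≺-irrefl x≡y)
  ... | no  x≢y with ≺-connex x≢y
  ... | inj₁ x≺y = yes x≺y
  ... | inj₂ y≺x = no (λ x≺y → ≺-irrefl refl (≺-trans x≺y y≺x))

  rank : Fin n → ℕ
  rank y = count (_≺? y)

  rank-mono : ∀ {x y} → x ≺ y → rank x < rank y
  rank-mono x≺y = count-strict-mono (_≺? _) (_≺? _) (λ w≺x → ≺-trans w≺x x≺y) x≺y (≺-irrefl refl)

  embed : Fin n → ℚ
  embed = ℕ→ℚ ∘ rank

  embed-mono : ∀ {x y} → x ≺ y → embed x ℚ.< embed y
  embed-mono = ℕ→ℚ-mono-< ∘ rank-mono

  embed-reflects : ∀ {x y} → embed x ℚ.< embed y → x ≺ y
  embed-reflects {x} {y} fx<fy with x ≟ y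
  ... | yes refl = contradiction fx<fy (ℚ.<-irrefl refl)
  ... | no  x≢y with ≺-connex x≢y
  ... | inj₁ x≺y = x≺y
  ... | inj₂ y≺x = contradiction (embed-mono y≺x) (ℚ.<-asym fx<fy)

  embed-injective : Injective _≡_ _≡_ embed
  embed-injective {x} {y} fx≡fy with x ≟ y
  ... | yes x≡y = x≡y
  ... | no  x≢y with ≺-connex x≢y
  ... | inj₁ x≺y = contradiction (embed-mono x≺y) (ℚ.<-irrefl fx≡fy)
  ... | inj₂ y≺x = contradiction (embed-mono y≺x) (ℚ.<-irrefl (sym fx≡fy))

  Between⇔StrictlyBetween : ∀ {x y z} →
    Between _≺_ x y z ⇔ StrictlyBetween (embed x) (embed y) (embed z)
  Between⇔StrictlyBetween = mk⇔ to from
    where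
    to : ∀ {x y z} → Between _≺_ x y z → StrictlyBetween (embed x) (embed y) (embed z)
    to (inj₁ (x≺y , y≺z)) = inj₁ (embed-mono x≺y , embed-mono y≺z)
    to (inj₂ (z≺y , y≺x)) = inj₂ (embed-mono z≺y , embed-mono y≺x)
    from : ∀ {x y z} → StrictlyBetween (embed x) (embed y) (embed z) → Between _≺_ x y z
    from (inj₁ (fx<fy , fy<fz)) = inj₁ (embed-reflects fx<fy , embed-reflects fy<fz)
    from (inj₂ (fz<fy , fy<fx)) = inj₂ (embed-reflects fz<fy , embed-reflects fy<fx)

Total : {V : Set} → Ternary V → Set
Total B = ∀ {u v w} → Distinct₃ u v w → B u v w ⊎ B v u w ⊎ B u w v

pattern here₁ = inj₁ refl
pattern here₂ = inj₂ (inj₁ refl)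
pattern here₃ = inj₂ (inj₂ refl)

module Betweenness {V : Set} {B : Ternary V} (pb : PseudometricBetweenness B) where
  open PseudometricBetweenness pb public

  ¬B-swap₁₂ : ∀ {u v w} → B u v w → ¬ B v u w
  ¬B-swap₁₂ Buvw Bvuw = M2 (M1 Buvw) (M1 Bvuw)

  B-trans-from : ∀ a → Transitive (B a)
  B-trans-from a Bavw Bawx = proj₁ (M3 Bavw Bawx)

  B-irrefl-from : ∀ a → Irreflexive _≡_ (B a)
  B-irrefl-from a refl Bavv = proj₁ (proj₂ (M0 Bavv)) refl

  B-from-middle : ∀ {a b c u v w} → Distinct₃ u v w → B a b c →
                  u ∈₃ (a , b , c) → w ∈₃ (a , b , c) → b ≡ v → B u v w
  B-from-middle _             Babc here₁ here₃ refl = Babc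
  B-from-middle _             Babc here₃ here₁ refl = M1 Babc
  B-from-middle (u≢v , _ , _) _    here₂ _     refl = contradiction refl u≢v
  B-from-middle (_ , v≢w , _) _    _     here₂ refl = contradiction refl v≢w
  B-from-middle (_ , _ , u≢w) _    here₁ here₁ refl = contradiction refl u≢w
  B-from-middle (_ , _ , u≢w) _    here₃ here₃ refl = contradiction refl u≢w

  covers⇒total : CoversAllTriples B → Total B
  covers⇒total (_ , covers) {u} {v} {w} d@(u≢v , v≢w , u≢w) with covers u v w d
  ... | a , b , c , Babc , same with Equivalence.to (same b) here₂
  ... | inj₁ b≡u = inj₂ (inj₁ (B-from-middle (≢-sym u≢v , u≢w , v≢w) Babc
                     (Equivalence.from (same v) here₂) (Equivalence.from (same w) here₃) b≡u))
  ... | inj₂ (inj₁ b≡v) = inj₁ (B-from-middle d Babc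
                     (Equivalence.from (same u) here₁) (Equivalence.from (same w) here₃) b≡v)
  ... | inj₂ (inj₂ b≡w) = inj₂ (inj₂ (B-from-middle (u≢w , ≢-sym v≢w , u≢v) Babc
                     (Equivalence.from (same u) here₁) (Equivalence.from (same v) here₂) b≡w))

module TotalBetweenness {V : Set} (_≟V_ : DecidableEquality V)
         {B : Ternary V} (pb : PseudometricBetweenness B) (total : Total B) where
  open Betweenness pb

  B? : ∀ u v w → Dec (B u v w)
  B? u v w with u ≟V v | v ≟V w | u ≟V w
  ... | yes u≡v | _       | _       = no (λ Buvw → proj₁ (M0 Buvw) u≡v)
  ... | no  _   | yes v≡w | _       = no (λ Buvw → proj₁ (proj₂ (M0 Buvw)) v≡w)
  ... | no  _   | no  _   | yes u≡w = no (λ Buvw → proj₂ (proj₂ (M0 Buvw)) u≡w)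
  ... | no u≢v  | no v≢w  | no u≢w with total (u≢v , v≢w , u≢w)
  ... | inj₁ Buvw        = yes Buvw
  ... | inj₂ (inj₁ Bvuw) = no (λ Buvw → ¬B-swap₁₂ Buvw Bvuw)
  ... | inj₂ (inj₂ Buwv) = no (λ Buvw → M2 Buvw Buwv)

  ¬B-beyond-both : ∀ {a b c z} → B a b c → B a b z → B c b z → ⊥
  ¬B-beyond-both Babc Babz Bcbz
    with total (proj₂ (proj₂ (M0 Babc)) , proj₂ (proj₂ (M0 Bcbz)) , proj₂ (proj₂ (M0 Babz)))
  ... | inj₁ Bacz        = ¬B-swap₁₂ (proj₂ (M3 Babc Bacz)) Bcbz
  ... | inj₂ (inj₁ Bcaz) = ¬B-swap₁₂ (proj₂ (M3 (M1 Babc) Bcaz)) Babz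
  ... | inj₂ (inj₂ Bazc) = ¬B-swap₁₂ (proj₂ (M3 Babz Bazc)) (M1 Bcbz)

  Cycle₄ : V → V → V → V → Set
  Cycle₄ c₀ c₁ c₂ c₃ = B c₃ c₀ c₁ × B c₀ c₁ c₂ × B c₁ c₂ c₃ × B c₂ c₃ c₀

  rotate : ∀ {c₀ c₁ c₂ c₃} → Cycle₄ c₀ c₁ c₂ c₃ → Cycle₄ c₁ c₂ c₃ c₀
  rotate (B301 , B012 , B123 , B230) = B012 , B123 , B230 , B301

  reflect : ∀ {c₀ c₁ c₂ c₃} → Cycle₄ c₀ c₁ c₂ c₃ → Cycle₄ c₁ c₀ c₃ c₂
  reflect (B301 , B012 , B123 , B230) = M1 B012 , M1 B301 , M1 B230 , M1 B123

  cycle-no-inner : ∀ {c₀ c₁ c₂ c₃ z} → Cycle₄ c₀ c₁ c₂ c₃ → c₂ ≢ z → c₃ ≢ z → ¬ B c₀ z c₁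
  cycle-no-inner (B301 , B012 , B123 , _) c₂≢z c₃≢z B0z1
    with M3 (M1 B0z1) (M1 B301) | M3 B0z1 B012 | total (proj₁ (proj₂ (M0 B123)) , c₃≢z , c₂≢z)
  ... | B1z3 , Bz03 | B0z2 , Bz12 | inj₁ B23z        = M2 (proj₂ (M3 B23z (M1 B0z2))) (M1 Bz03)
  ... | B1z3 , Bz03 | B0z2 , Bz12 | inj₂ (inj₁ B32z) = M2 (proj₂ (M3 B32z (M1 B1z3))) (M1 Bz12)
  ... | B1z3 , Bz03 | B0z2 , Bz12 | inj₂ (inj₂ B2z3) = ¬B-swap₁₂ B123 (proj₁ (M3 (M1 Bz12) B2z3))

  cycle-no-outer : ∀ {c₀ c₁ c₂ c₃ z} → Cycle₄ c₀ c₁ c₂ c₃ → c₂ ≢ z → c₃ ≢ z → ¬ B c₀ c₁ z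
  cycle-no-outer {c₂ = c₂} {c₃} {z} cyc@(_ , B012 , B123 , B230) c₂≢z c₃≢z B01z
    with total (proj₁ (proj₂ (M0 B012)) , c₂≢z , proj₁ (proj₂ (M0 B01z)))
  ... | inj₁ B12z        = ¬B-beyond-both B123 B12z B32z
    where
    B32z : B c₃ c₂ z
    B32z = proj₂ (M3 (M1 B230) (M1 (proj₁ (M3 (M1 B12z) (M1 B01z)))))
  ... | inj₂ (inj₁ B21z) = ¬B-beyond-both B012 B01z B21z
  ... | inj₂ (inj₂ B1z2) = cycle-no-inner (rotate cyc) c₃≢z (proj₂ (proj₂ (M0 B01z))) B1z2

  cycle-no-fifth : ∀ {c₀ c₁ c₂ c₃ z} → Cycle₄ c₀ c₁ c₂ c₃ →
                   c₀ ≢ z → c₁ ≢ z → c₂ ≢ z → c₃ ≢ z → ⊥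
  cycle-no-fifth cyc@(_ , B012 , _ , _) c₀≢z c₁≢z c₂≢z c₃≢z
    with total (proj₁ (M0 B012) , c₁≢z , c₀≢z)
  ... | inj₁ B01z        = cycle-no-outer cyc c₂≢z c₃≢z B01z
  ... | inj₂ (inj₁ B10z) = cycle-no-outer (reflect cyc) c₃≢z c₂≢z B10z
  ... | inj₂ (inj₂ B0z1) = cycle-no-inner cyc c₂≢z c₃≢z B0z1

  module _ (five : ∀ (p : Fin 4 → V) → ∃ λ z → ∀ i → p i ≢ z) {a m : V}
           (a≢m : a ≢ m) (m-far : ∀ y → ¬ B a m y) where

    toward-m : ∀ {x y} → B x m y → x ≢ a → B a x m
    toward-m {x} {y} Bxmy x≢a with total (a≢m , ≢-sym (proj₁ (M0 Bxmy)) , ≢-sym x≢a)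
    ... | inj₁ Bamx        = contradiction Bamx (m-far x)
    ... | inj₂ (inj₁ Bmax) = contradiction (proj₂ (M3 (M1 Bmax) Bxmy)) (m-far y)
    ... | inj₂ (inj₂ Baxm) = Baxm

    -- Ordering a, x, y any other way than B x a y contradicts B x m y; and B x a y
    -- closes the 4-cycle x–a–y–m.
    no-B-between : ∀ {x y} → B a x m → B a y m → ¬ B x m y
    no-B-between {x} {y} Baxm Baym Bxmy
      with total (proj₁ (M0 Baxm) , proj₂ (proj₂ (M0 Bxmy)) , proj₁ (M0 Baym))
    ... | inj₁ Baxy        = M2 Bxmy (proj₂ (M3 Baxy Baym))
    ... | inj₂ (inj₂ Bayx) = M2 (M1 Bxmy) (proj₂ (M3 Bayx Baxm))
    ... | inj₂ (inj₁ Bxay) with five (lookup (x ∷ a ∷ y ∷ m ∷ []))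
    ... | z , fresh = cycle-no-fifth (M1 Baxm , Bxay , Baym , M1 Bxmy)
                        (fresh zero) (fresh (suc zero)) (fresh (suc (suc zero))) (fresh (suc (suc (suc zero))))

    far⇒endpoint : ∀ x y → ¬ B x m y
    far⇒endpoint x y Bxmy with x ≟V a | y ≟V a
    ... | yes refl | _        = m-far y Bxmy
    ... | no  _    | yes refl = m-far x (M1 Bxmy)
    ... | no  x≢a  | no  y≢a  = no-B-between (toward-m Bxmy x≢a) (toward-m (M1 Bxmy) y≢a) Bxmy

  module EndpointOrder (e : V) (e-endpoint : ∀ x y → ¬ B x e y) where

    _≺_ : Rel V 0ℓ
    x ≺ y = (x ≡ e × y ≢ e) ⊎ B e x y

    ≺-target-≢ : ∀ {x y} → x ≺ y → y ≢ e
    ≺-target-≢ (inj₁ (_ , y≢e)) = y≢e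
    ≺-target-≢ (inj₂ Bexy) y≡e = proj₂ (proj₂ (M0 Bexy)) (sym y≡e)

    ≺-irrefl : Irreflexive _≡_ _≺_
    ≺-irrefl refl (inj₁ (x≡e , x≢e)) = x≢e x≡e
    ≺-irrefl refl (inj₂ Bexx)        = B-irrefl-from e refl Bexx

    ≺-trans : Transitive _≺_
    ≺-trans (inj₁ (x≡e , _)) y≺z                 = inj₁ (x≡e , ≺-target-≢ y≺z)
    ≺-trans x≺y              (inj₁ (y≡e , _))    = contradiction y≡e (≺-target-≢ x≺y)
    ≺-trans (inj₂ Bexy)      (inj₂ Beyz)         = inj₂ (B-trans-from e Bexy Beyz)

    ≺-connex : ∀ {x y} → x ≢ y → x ≺ y ⊎ y ≺ x
    ≺-connex {x} {y} x≢y with x ≟V e | y ≟V e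
    ... | yes x≡e | _       = inj₁ (inj₁ (x≡e , λ y≡e → x≢y (trans x≡e (sym y≡e))))
    ... | no  x≢e | yes y≡e = inj₂ (inj₁ (y≡e , x≢e))
    ... | no  x≢e | no  y≢e with total (≢-sym x≢e , x≢y , ≢-sym y≢e)
    ... | inj₁ Bexy        = inj₁ (inj₂ Bexy)
    ... | inj₂ (inj₁ Bxey) = contradiction Bxey (e-endpoint x y)
    ... | inj₂ (inj₂ Beyx) = inj₂ (inj₂ Beyx)

    ≺-chain⇒B : ∀ {x y z} → x ≺ y → y ≺ z → B x y z
    ≺-chain⇒B (inj₁ (refl , _)) (inj₂ Beyz)      = Beyz
    ≺-chain⇒B x≺y               (inj₁ (y≡e , _)) = contradiction y≡e (≺-target-≢ x≺y)
    ≺-chain⇒B (inj₂ Bexy)       (inj₂ Beyz)      = proj₂ (M3 Bexy Beyz)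

    ¬B-middle-max : ∀ {x y z} → B x y z → x ≺ y → z ≺ y → ⊥
    ¬B-middle-max Bxyz x≺y z≺y with ≺-connex (proj₂ (proj₂ (M0 Bxyz)))
    ... | inj₁ x≺z = M2 Bxyz (≺-chain⇒B x≺z z≺y)
    ... | inj₂ z≺x = M2 (M1 Bxyz) (≺-chain⇒B z≺x x≺y)

    ¬B-middle-min : ∀ {x y z} → B x y z → y ≺ x → y ≺ z → ⊥
    ¬B-middle-min Bxyz y≺x y≺z with ≺-connex (proj₂ (proj₂ (M0 Bxyz)))
    ... | inj₁ x≺z = ¬B-swap₁₂ Bxyz (≺-chain⇒B y≺x x≺z)
    ... | inj₂ z≺x = ¬B-swap₁₂ (M1 Bxyz) (≺-chain⇒B y≺z z≺x)

    B⇔Between : ∀ {x y z} → B x y z ⇔ Between _≺_ x y z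
    B⇔Between = mk⇔ to from
      where
      to : ∀ {x y z} → B x y z → Between _≺_ x y z
      to Bxyz with ≺-connex (proj₁ (M0 Bxyz)) | ≺-connex (proj₁ (proj₂ (M0 Bxyz)))
      ... | inj₁ x≺y | inj₁ y≺z = inj₁ (x≺y , y≺z)
      ... | inj₂ y≺x | inj₂ z≺y = inj₂ (z≺y , y≺x)
      ... | inj₁ x≺y | inj₂ z≺y = contradiction z≺y (¬B-middle-max Bxyz x≺y)
      ... | inj₂ y≺x | inj₁ y≺z = contradiction y≺z (¬B-middle-min Bxyz y≺x)
      from : ∀ {x y z} → Between _≺_ x y z → B x y z
      from (inj₁ (x≺y , y≺z)) = ≺-chain⇒B x≺y y≺z
      from (inj₂ (z≺y , y≺x)) = M1 (≺-chain⇒B z≺y y≺x)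

lemma1 : (n : ℕ) → n ≥ 5 → (B : Ternary (Fin n)) →
    PseudometricBetweenness B → CoversAllTriples B →
    Σ (Fin n → ℚ) (λ f → Injective _≡_ _≡_ f ×
      (∀ x y z → B x y z ⇔ StrictlyBetween (f x) (f y) (f z)))
lemma1 1 (s≤s ()) _ _ _
lemma1 (suc (suc k)) 5≤n B pb cov =
  embed , embed-injective , λ x y z → ⇔-trans B⇔Between Between⇔StrictlyBetween
  where
  open Betweenness pb
  open TotalBetweenness _≟_ pb (covers⇒total cov)

  farthest : ∃ λ j → ∀ i → ¬ B zero (suc j) (suc i)
  farthest = ∃-maximal (B-trans-from zero) (B-irrefl-from zero) (B? zero) suc

  m : Fin (suc (suc k))
  m = suc (proj₁ farthest)

  m-far : ∀ y → ¬ B zero m y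
  m-far zero    B0m0 = proj₂ (proj₂ (M0 B0m0)) refl
  m-far (suc i) = proj₂ farthest i

  open EndpointOrder m (far⇒endpoint (∃-∉-image 5≤n) (λ ()) m-far)
  open RankEmbedding ≺-trans ≺-irrefl ≺-connex
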